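{- For every integer $n\geq1$, $B_n=C_n$, where $B_n=|P(T,n\times(n+1))|$ and $C_n=|P(T,(n+1)\times n)|$.
   Context: Work over the alphabet $\{0,1\}$ and regard patterns as binary matrices. The block substitution $\mu$ maps $0$ to the $3\times3$ matrix with rows $(1,0,1),(0,0,0),(1,0,1)$ and $1$ to the $3\times3$ matrix with rows $(0,1,0),(1,1,1),(0,1,0)$; it acts on a binary matrix by replacing each entry by its $3\times3$ image block. Let $T_k=\mu^k(0)$; the squiral tiling $T$ is their limit. $P(T,m\times n)=\bigcup_{k\ge0}P(T_k,m\times n)$, where $P(S,m\times n)$ is the set of all $m\times n$ contiguous submatrices of $S$; so $P(T,m\times n)$ is the set of $m\times n$ patterns occurring in $T$ (matrices with $m$ rows and $n$ columns). -}

module Defs where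

open import Data.Bool using (Bool; true; false)
open import Data.Nat using (ℕ; zero; suc; _+_; _*_)
open import Data.Fin using (Fin; toℕ)
open import Data.Maybe using (Maybe; just; nothing)
open import Data.Vec using (Vec; []; _∷_; lookup; map; concat; tabulate)
open import Data.List using (List; length)
open import Data.List.Membership.Propositional using (_∈_)
open import Data.List.Relation.Unary.Unique.Propositional using (Unique)
open import Data.Product using (Σ; ∃; _×_)
open import Relation.Binary.PropositionalEquality using (_≡_)
open import Function.Bundles using (_⇔_)

-- A binary matrix with r rows and c columns (0 = false, 1 = true).
Matrix : ℕ → ℕ → Set
Matrix r c = Vec (Vec Bool c) r

block : Bool → Matrix 3 3
block false = (true ∷ false ∷ true ∷ []) ∷ (false ∷ false ∷ false ∷ []) ∷ (true ∷ false ∷ true ∷ []) ∷ []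
block true  = (false ∷ true ∷ false ∷ []) ∷ (true ∷ true ∷ true ∷ []) ∷ (false ∷ true ∷ false ∷ []) ∷ []

expandRow : ∀ {c} → Vec Bool c → Matrix 3 (c * 3)
expandRow row = tabulate (λ t → concat (map (λ b → lookup (block b) t) row))

μ : ∀ {r c} → Matrix r c → Matrix (r * 3) (c * 3)
μ M = concat (map expandRow M)

size : ℕ → ℕ
size zero = 1
size (suc k) = size k * 3

T : (k : ℕ) → Matrix (size k) (size k)
T zero = (false ∷ []) ∷ []
T (suc k) = μ (T k)

at : ∀ {A : Set} {n} → Vec A n → ℕ → Maybe A
at [] _ = nothing
at (x ∷ xs) zero = just x
at (x ∷ xs) (suc i) = at xs i

entry : ∀ {r c} → Matrix r c → ℕ → ℕ → Maybe Bool
entry M i j with at M i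
... | nothing = nothing
... | just row = at row j

-- p ∈ P(S, m×n): p is the contiguous submatrix of S with top-left corner (i, j).
-- (Out-of-range positions give nothing, so the bounds are enforced.)
OccursIn : ∀ {m n r c} → Matrix m n → Matrix r c → Set
OccursIn {m} {n} p S = Σ ℕ λ i → Σ ℕ λ j →
  (a : Fin m) (b : Fin n) → entry S (i + toℕ a) (j + toℕ b) ≡ just (lookup (lookup p a) b)

InP : ∀ {m n} → Matrix m n → Set
InP p = Σ ℕ λ k → OccursIn p (T k)

HasCard : {A : Set} → (A → Set) → ℕ → Set
HasCard {A} P N = Σ (List A) λ l → Unique l × ((x : A) → (x ∈ l ⇔ P x)) × length l ≡ N

CardP : (m n N : ℕ) → Set
CardP m n N = HasCard (InP {m} {n}) N

{-# OPTIONS --safe #-}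
-- Both blocks of μ are symmetric matrices, so every T_k is symmetric and transposition maps the
-- n×(n+1) patterns of T bijectively onto the (n+1)×n ones. What needs work is that P(T, m×n) is a
-- finite, decidable set at all, i.e. that the union over k stabilises. An m×n window of
-- T_{k+1} = μ(T_k) is determined by a window of T_k with sides about a third as long, namely the
-- entries whose blocks it meets; iterating, every window with sides at most 3^J + 1 already occurs
-- in T_{J+2}. The sides stop shrinking at 2, and the 2×2 windows are settled by checking that
-- those of T_3 all occur in T_2.
module Submission where

open import Defs
open import Data.Bool using (Bool; true; false)
import Data.Bool.Properties as Bool
open import Data.Fin using (Fin; toℕ; fromℕ<)
open import Data.Fin.Properties using (toℕ<n; toℕ-fromℕ<; fromℕ<-cong)
open import Data.List using (List; []; _∷_; length; filter; deduplicate; cartesianProductWith)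
import Data.List as List
open import Data.List.Membership.Propositional using (_∈_)
open import Data.List.Membership.Propositional.Properties
  using (∈-map⁺; ∈-map⁻; ∈-filter⁺; ∈-filter⁻; ∈-deduplicate⁺; ∈-deduplicate⁻; ∈-cartesianProductWith⁺)
open import Data.List.Properties using (length-map)
open import Data.List.Relation.Unary.Any using (here; there)
import Data.List.Relation.Unary.Unique.Propositional.Properties as Unique
open import Data.List.Relation.Unary.Unique.DecPropositional.Properties using (deduplicate-!)
open import Data.Maybe using (Maybe; just; nothing; Is-just)
import Data.Maybe as Maybe
import Data.Maybe.Properties as Maybe
open import Data.Maybe.Relation.Unary.Any using (just)
open import Data.Nat using (ℕ; zero; suc; pred; NonZero; _+_; _*_; _≤_; _<_; _≥_; z≤n; s≤s)
open import Data.Nat.DivMod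
open import Data.Nat.Divisibility using (divides)
open import Data.Nat.Properties
open import Data.Product using (Σ; ∃; ∃₂; _×_; _,_; proj₁; proj₂)
open import Data.Sum using (_⊎_; inj₁; inj₂)
open import Data.Unit using (tt)
open import Data.Vec using (Vec; []; _∷_; _++_; lookup; map; concat; tabulate)
open import Data.Vec.Properties using (lookup∘tabulate; tabulate∘lookup; tabulate-cong)
import Data.Vec.Properties as Vec
open import Function.Bundles using (_⇔_; mk⇔; Equivalence; _↔_; mk↔ₛ′; Inverse)
open import Relation.Binary.Definitions using (DecidableEquality)
open import Relation.Binary.PropositionalEquality
open import Relation.Nullary.Decidable using (Dec; toWitness; _⊎-dec_)
import Relation.Nullary.Decidable as Dec
open import Relation.Unary using (Decidable)

private
  variable
    A B : Set
    m n r c : ℕ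

[m*d+n]/d≡m+n/d : ∀ m n d .{{_ : NonZero d}} → (m * d + n) / d ≡ m + n / d
[m*d+n]/d≡m+n/d m n d =
  trans (+-distrib-/-∣ˡ n (divides m refl)) (cong (_+ n / d) (m*n/n≡m m d))

[m*d+n]mod[d]≡n-mod[d] : ∀ m n d .{{_ : NonZero d}} → (m * d + n) mod d ≡ n mod d
[m*d+n]mod[d]≡n-mod[d] m n d = fromℕ<-cong _ _
  (trans (cong (_% d) (+-comm (m * d) n)) ([m+kn]%n≡m%n n m d)) (m%n<n _ d) (m%n<n n d)

m+n≡[m/d]*d+[m%d+n] : ∀ m n d .{{_ : NonZero d}} → m + n ≡ m / d * d + (m % d + n)
m+n≡[m/d]*d+[m%d+n] m n d = begin
  m + n                     ≡⟨ cong (_+ n) (m≡m%n+[m/n]*n m d) ⟩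
  m % d + m / d * d + n     ≡⟨ cong (_+ n) (+-comm (m % d) (m / d * d)) ⟩
  m / d * d + m % d + n     ≡⟨ +-assoc (m / d * d) (m % d) n ⟩
  m / d * d + (m % d + n)   ∎
  where open ≡-Reasoning

m/d<n⇒m<n*d : ∀ {m n d} .{{_ : NonZero d}} → m / d < n → m < n * d
m/d<n⇒m<n*d {m} {n} {d} m/d<n = begin-strict
  m                 ≡⟨ m≡m%n+[m/n]*n m d ⟩
  m % d + m / d * d <⟨ +-monoˡ-< (m / d * d) (m%n<n m d) ⟩
  suc (m / d) * d   ≤⟨ *-monoˡ-≤ d m/d<n ⟩
  n * d             ∎
  where open ≤-Reasoning

-- Indexing by natural numbers

Is-just-map⁻ : ∀ {f : A → B} (x : Maybe A) → Is-just (Maybe.map f x) → Is-just x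
Is-just-map⁻ (just _) _ = just tt

at-lookup : ∀ (xs : Vec A n) (a : Fin n) → at xs (toℕ a) ≡ just (lookup xs a)
at-lookup (x ∷ xs) Fin.zero    = refl
at-lookup (x ∷ xs) (Fin.suc a) = at-lookup xs a

at-map : ∀ (f : A → B) (xs : Vec A n) i → at (map f xs) i ≡ Maybe.map f (at xs i)
at-map f []       i       = refl
at-map f (x ∷ xs) zero    = refl
at-map f (x ∷ xs) (suc i) = at-map f xs i

at-++ˡ : ∀ (xs : Vec A m) (ys : Vec A n) (a : Fin m) → at (xs ++ ys) (toℕ a) ≡ just (lookup xs a)
at-++ˡ (x ∷ xs) ys Fin.zero    = refl
at-++ˡ (x ∷ xs) ys (Fin.suc a) = at-++ˡ xs ys a

at-++ʳ : ∀ (xs : Vec A m) (ys : Vec A n) i → at (xs ++ ys) (m + i) ≡ at ys i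
at-++ʳ []       ys i = refl
at-++ʳ (x ∷ xs) ys i = at-++ʳ xs ys i

at-concat : ∀ (xss : Vec (Vec A n) m) q (s : Fin n) →
            at (concat xss) (q * n + toℕ s) ≡ Maybe.map (λ xs → lookup xs s) (at xss q)
at-concat []         q       s = refl
at-concat (xs ∷ xss) zero    s = at-++ˡ xs (concat xss) s
at-concat {n = n} (xs ∷ xss) (suc q) s = begin
  at (xs ++ concat xss) (n + q * n + toℕ s)   ≡⟨ cong (at (xs ++ concat xss)) (+-assoc n (q * n) (toℕ s)) ⟩
  at (xs ++ concat xss) (n + (q * n + toℕ s)) ≡⟨ at-++ʳ xs (concat xss) (q * n + toℕ s) ⟩
  at (concat xss) (q * n + toℕ s)             ≡⟨ at-concat xss q s ⟩
  Maybe.map (λ xs → lookup xs s) (at xss q)   ∎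
  where open ≡-Reasoning

at-concat-divMod : ∀ .{{_ : NonZero n}} (xss : Vec (Vec A n) m) i →
                   at (concat xss) i ≡ Maybe.map (λ xs → lookup xs (i mod n)) (at xss (i / n))
at-concat-divMod {n = n} xss i = trans (cong (at (concat xss)) i≡) (at-concat xss (i / n) (i mod n))
  where
  i≡ : i ≡ i / n * n + toℕ (i mod n)
  i≡ = trans (m≡m%n+[m/n]*n i n)
       (trans (+-comm (i % n) (i / n * n)) (cong (i / n * n +_) (sym (toℕ-fromℕ< (m%n<n i n)))))

entry-at : ∀ (M : Matrix m n) i j → entry M i j ≡ Maybe.maybe (λ row → at row j) nothing (at M i)
entry-at M i j with at M i
... | nothing  = refl
... | just row = refl

entry-lookup : ∀ (M : Matrix m n) a b → entry M (toℕ a) (toℕ b) ≡ just (lookup (lookup M a) b)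
entry-lookup M a b rewrite entry-at M (toℕ a) (toℕ b) | at-lookup M a = at-lookup (lookup M a) b

entry-defined : ∀ (M : Matrix m n) → r < m → c < n → Is-just (entry M r c)
entry-defined M r<m c<n
  rewrite sym (toℕ-fromℕ< r<m) | sym (toℕ-fromℕ< c<n) | entry-lookup M (fromℕ< r<m) (fromℕ< c<n) = just tt

_ᵀ : Matrix m n → Matrix n m
M ᵀ = tabulate λ b → tabulate λ a → lookup (lookup M a) b

lookup-ᵀ : ∀ (M : Matrix m n) a b → lookup (lookup (M ᵀ) b) a ≡ lookup (lookup M a) b
lookup-ᵀ M a b = trans (cong (λ row → lookup row a) (lookup∘tabulate _ b)) (lookup∘tabulate _ a)

ᵀ-involutive : ∀ (M : Matrix m n) → M ᵀ ᵀ ≡ M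
ᵀ-involutive M = trans
  (tabulate-cong λ a → trans (tabulate-cong λ b → lookup-ᵀ M a b) (tabulate∘lookup (lookup M a)))
  (tabulate∘lookup M)

-- The squiral tiling cell by cell

cell : Bool → Fin 3 → Fin 3 → Bool
cell b s t = lookup (lookup (block b) s) t

squiral : ℕ → ℕ → ℕ → Maybe Bool
squiral zero    zero    zero    = just false
squiral zero    zero    (suc _) = nothing
squiral zero    (suc _) _       = nothing
squiral (suc k) i j = Maybe.map (λ b → cell b (i mod 3) (j mod 3)) (squiral k (i / 3) (j / 3))

at-μ : ∀ (M : Matrix m n) i →
       at (μ M) i ≡ Maybe.map (λ row → concat (map (λ b → lookup (block b) (i mod 3)) row)) (at M (i / 3))
at-μ M i = begin
  at (concat (map expandRow M)) i
    ≡⟨ at-concat-divMod (map expandRow M) i ⟩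
  Maybe.map (λ rows → lookup rows (i mod 3)) (at (map expandRow M) (i / 3))
    ≡⟨ cong (Maybe.map _) (at-map expandRow M (i / 3)) ⟩
  Maybe.map (λ rows → lookup rows (i mod 3)) (Maybe.map expandRow (at M (i / 3)))
    ≡⟨ sym (Maybe.map-∘ (at M (i / 3))) ⟩
  Maybe.map (λ row → lookup (expandRow row) (i mod 3)) (at M (i / 3))
    ≡⟨ Maybe.map-cong (λ row → lookup∘tabulate (λ t → concat (map (λ b → lookup (block b) t) row)) (i mod 3))
                      (at M (i / 3)) ⟩
  Maybe.map (λ row → concat (map (λ b → lookup (block b) (i mod 3)) row)) (at M (i / 3))
    ∎
  where open ≡-Reasoning

entry-μ : ∀ (M : Matrix m n) i j →
          entry (μ M) i j ≡ Maybe.map (λ b → cell b (i mod 3) (j mod 3)) (entry M (i / 3) (j / 3))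
entry-μ M i j rewrite entry-at (μ M) i j | entry-at M (i / 3) (j / 3) | at-μ M i with at M (i / 3)
... | nothing  = refl
... | just row = begin
  at (concat (map (λ b → lookup (block b) (i mod 3)) row)) j
    ≡⟨ at-concat-divMod (map (λ b → lookup (block b) (i mod 3)) row) j ⟩
  Maybe.map (λ xs → lookup xs (j mod 3)) (at (map (λ b → lookup (block b) (i mod 3)) row) (j / 3))
    ≡⟨ cong (Maybe.map _) (at-map _ row (j / 3)) ⟩
  Maybe.map (λ xs → lookup xs (j mod 3)) (Maybe.map (λ b → lookup (block b) (i mod 3)) (at row (j / 3)))
    ≡⟨ sym (Maybe.map-∘ (at row (j / 3))) ⟩
  Maybe.map (λ b → cell b (i mod 3) (j mod 3)) (at row (j / 3))
    ∎
  where open ≡-Reasoning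

entry-T : ∀ k i j → entry (T k) i j ≡ squiral k i j
entry-T zero    zero    zero    = refl
entry-T zero    zero    (suc j) = refl
entry-T zero    (suc i) j       = refl
entry-T (suc k) i j =
  trans (entry-μ (T k) i j) (cong (Maybe.map _) (entry-T k (i / 3) (j / 3)))

squiral-bound : ∀ k i j → Is-just (squiral k i j) → i < size k × j < size k
squiral-bound zero zero zero _ = s≤s z≤n , s≤s z≤n
squiral-bound (suc k) i j defined
  with squiral-bound k (i / 3) (j / 3) (Is-just-map⁻ (squiral k (i / 3) (j / 3)) defined)
... | i/3<size , j/3<size = m/d<n⇒m<n*d i/3<size , m/d<n⇒m<n*d j/3<size

squiral-suc : ∀ k x s y t → squiral (suc k) (x * 3 + s) (y * 3 + t) ≡
              Maybe.map (λ b → cell b (s mod 3) (t mod 3)) (squiral k (x + s / 3) (y + t / 3))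
squiral-suc k x s y t =
  trans (cong₂ (from-parent ((x * 3 + s) / 3) ((y * 3 + t) / 3))
               ([m*d+n]mod[d]≡n-mod[d] x s 3) ([m*d+n]mod[d]≡n-mod[d] y t 3))
        (cong₂ (λ u v → from-parent u v (s mod 3) (t mod 3)) ([m*d+n]/d≡m+n/d x s 3) ([m*d+n]/d≡m+n/d y t 3))
  where
  from-parent : ℕ → ℕ → Fin 3 → Fin 3 → Maybe Bool
  from-parent u v σ τ = Maybe.map (λ b → cell b σ τ) (squiral k u v)

block-ᵀ : ∀ b → block b ᵀ ≡ block b
block-ᵀ false = refl
block-ᵀ true  = refl

cell-sym : ∀ b s t → cell b s t ≡ cell b t s
cell-sym b s t = sym (trans (cong (λ B → lookup (lookup B t) s) (sym (block-ᵀ b))) (lookup-ᵀ (block b) s t))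

squiral-sym : ∀ k i j → squiral k i j ≡ squiral k j i
squiral-sym zero    zero    zero    = refl
squiral-sym zero    zero    (suc j) = refl
squiral-sym zero    (suc i) zero    = refl
squiral-sym zero    (suc i) (suc j) = refl
squiral-sym (suc k) i j = trans (cong (Maybe.map _) (squiral-sym k (i / 3) (j / 3)))
                                (Maybe.map-cong (λ b → cell-sym b (i mod 3) (j mod 3)) (squiral k (j / 3) (i / 3)))

centre : ℕ → ℕ
centre zero    = 0
centre (suc k) = centre k * 3 + 1

squiral-centre : ∀ k → squiral k (centre k) (centre k) ≡ just false
squiral-centre zero    = refl
squiral-centre (suc k) = begin
  squiral (suc k) (centre k * 3 + 1) (centre k * 3 + 1)
    ≡⟨ squiral-suc k (centre k) 1 (centre k) 1 ⟩
  Maybe.map (λ b → cell b (1 mod 3) (1 mod 3)) (squiral k (centre k + 0) (centre k + 0))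
    ≡⟨ cong (λ x → Maybe.map (λ b → cell b (1 mod 3) (1 mod 3)) (squiral k x x)) (+-identityʳ (centre k)) ⟩
  Maybe.map (λ b → cell b (1 mod 3) (1 mod 3)) (squiral k (centre k) (centre k))
    ≡⟨ cong (Maybe.map (λ b → cell b (1 mod 3) (1 mod 3))) (squiral-centre k) ⟩
  just false
    ∎
  where open ≡-Reasoning

-- Desubstitution of windows

Grid : Set
Grid = ℕ → ℕ → Maybe Bool

shift : Grid → ℕ → ℕ → Grid
shift g i j r c = g (i + r) (j + c)

_≈[_,_]_ : Grid → ℕ → ℕ → Grid → Set
g ≈[ m , n ] h = ∀ {r} → r < m → ∀ {c} → c < n → g r c ≡ h r c

≈-sym : ∀ {g h} → g ≈[ m , n ] h → h ≈[ m , n ] g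
≈-sym g≈h r<m c<n = sym (g≈h r<m c<n)

≈-trans : ∀ {f g h} → f ≈[ m , n ] g → g ≈[ m , n ] h → f ≈[ m , n ] h
≈-trans f≈g g≈h r<m c<n = trans (f≈g r<m c<n) (g≈h r<m c<n)

≈-dec : ∀ g h m n → Dec (g ≈[ m , n ] h)
≈-dec g h m n = allUpTo? (λ r → allUpTo? (λ c → Maybe.≡-dec Bool._≟_ (g r c) (h r c)) n) m

parent-extent : ∀ J {i a} → a ≤ size J → (i % 3 + a) / 3 ≤ size (pred J)
parent-extent zero    {i} a≤1 = /-monoˡ-≤ 3 (+-mono-≤ (≤-pred (m%n<n i 3)) a≤1)
parent-extent (suc J) {i} {a} a≤ = begin
  (i % 3 + a) / 3       ≤⟨ /-monoˡ-≤ 3 (+-mono-≤ (≤-pred (m%n<n i 3)) a≤) ⟩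
  (2 + size J * 3) / 3  ≡⟨ cong (_/ 3) (+-comm 2 (size J * 3)) ⟩
  (size J * 3 + 2) / 3  ≡⟨ [m*d+n]/d≡m+n/d (size J) 2 3 ⟩
  size J + 0            ≡⟨ +-identityʳ (size J) ⟩
  size J                ∎
  where open ≤-Reasoning

parent-corner : ∀ i a → i / 3 + (i % 3 + a) / 3 ≡ (i + a) / 3
parent-corner i a =
  sym (trans (cong (_/ 3) (m+n≡[m/d]*d+[m%d+n] i a 3)) ([m*d+n]/d≡m+n/d (i / 3) (i % 3 + a) 3))

parent-defined : ∀ k {i j a b} → Is-just (squiral (suc k) (i + a) (j + b)) →
                 Is-just (squiral k (i / 3 + (i % 3 + a) / 3) (j / 3 + (j % 3 + b) / 3))
parent-defined k {i} {j} {a} {b} defined =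
  subst₂ (λ u v → Is-just (squiral k u v)) (sym (parent-corner i a)) (sym (parent-corner j b))
    (Is-just-map⁻ (squiral k ((i + a) / 3) ((j + b) / 3)) defined)

expand-window : ∀ {k l i j a b x y} →
  shift (squiral k) (i / 3) (j / 3) ≈[ suc ((i % 3 + a) / 3) , suc ((j % 3 + b) / 3) ] shift (squiral l) x y →
  shift (squiral (suc k)) i j ≈[ suc a , suc b ] shift (squiral (suc l)) (x * 3 + i % 3) (y * 3 + j % 3)
expand-window {k} {l} {i} {j} {a} {b} {x} {y} parents {r} r≤a {c} c≤b = begin
  squiral (suc k) (i + r) (j + c)
    ≡⟨ cong₂ (squiral (suc k)) (m+n≡[m/d]*d+[m%d+n] i r 3) (m+n≡[m/d]*d+[m%d+n] j c 3) ⟩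
  squiral (suc k) (i / 3 * 3 + (i % 3 + r)) (j / 3 * 3 + (j % 3 + c))
    ≡⟨ squiral-suc k (i / 3) (i % 3 + r) (j / 3) (j % 3 + c) ⟩
  Maybe.map cellʳᶜ (squiral k (i / 3 + (i % 3 + r) / 3) (j / 3 + (j % 3 + c) / 3))
    ≡⟨ cong (Maybe.map cellʳᶜ) (parents (s≤s (/-monoˡ-≤ 3 (+-monoʳ-≤ (i % 3) (≤-pred r≤a))))
                                         (s≤s (/-monoˡ-≤ 3 (+-monoʳ-≤ (j % 3) (≤-pred c≤b))))) ⟩
  Maybe.map cellʳᶜ (squiral l (x + (i % 3 + r) / 3) (y + (j % 3 + c) / 3))
    ≡⟨ squiral-suc l x (i % 3 + r) y (j % 3 + c) ⟨
  squiral (suc l) (x * 3 + (i % 3 + r)) (y * 3 + (j % 3 + c))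
    ≡⟨ cong₂ (squiral (suc l)) (+-assoc (x * 3) (i % 3) r) (+-assoc (y * 3) (j % 3) c) ⟨
  squiral (suc l) (x * 3 + i % 3 + r) (y * 3 + j % 3 + c)
    ∎
  where
  open ≡-Reasoning
  cellʳᶜ : Bool → Bool
  cellʳᶜ b = cell b ((i % 3 + r) mod 3) ((j % 3 + c) mod 3)

WindowOfT₃InT₂ : (a b x y : ℕ) → Set
WindowOfT₃InT₂ a b x y = squiral 3 (x + a) (y + b) ≡ nothing ⊎
  ∃ λ x′ → x′ < 9 × ∃ λ y′ → y′ < 9 × shift (squiral 3) x y ≈[ suc a , suc b ] shift (squiral 2) x′ y′

windowOfT₃InT₂? : ∀ a b x y → Dec (WindowOfT₃InT₂ a b x y)
windowOfT₃InT₂? a b x y = Maybe.≡-dec Bool._≟_ (squiral 3 (x + a) (y + b)) nothing ⊎-dec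
  anyUpTo? (λ x′ → anyUpTo? (λ y′ →
    ≈-dec (shift (squiral 3) x y) (shift (squiral 2) x′ y′) (suc a) (suc b)) 9) 9

small-windows-of-T₃-in-T₂ : ∀ {a} → a < 2 → ∀ {b} → b < 2 → ∀ {x} → x < 27 → ∀ {y} → y < 27 →
                            WindowOfT₃InT₂ a b x y
small-windows-of-T₃-in-T₂ = toWitness {a? = allUpTo? (λ a → allUpTo? (λ b → allUpTo? (λ x →
                                              allUpTo? (windowOfT₃InT₂? a b x) 27) 27) 2) 2} _

window-T₃⇒T₂ : ∀ {N i j a b x y} → a ≤ 1 → b ≤ 1 → Is-just (squiral N (i + a) (j + b)) →
  shift (squiral N) i j ≈[ suc a , suc b ] shift (squiral 3) x y →
  ∃₂ λ x′ y′ → shift (squiral N) i j ≈[ suc a , suc b ] shift (squiral 2) x′ y′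
window-T₃⇒T₂ {N} {i} {j} {a} {b} {x} {y} a≤1 b≤1 defined same =
  conclude (small-windows-of-T₃-in-T₂ (s≤s a≤1) (s≤s b≤1)
                                       (m+n≤o⇒m≤o (suc x) (proj₁ bounds)) (m+n≤o⇒m≤o (suc y) (proj₂ bounds)))
  where
  defined₃ : Is-just (squiral 3 (x + a) (y + b))
  defined₃ = subst Is-just (same ≤-refl ≤-refl) defined
  bounds : x + a < 27 × y + b < 27
  bounds = squiral-bound 3 (x + a) (y + b) defined₃
  conclude : WindowOfT₃InT₂ a b x y →
             ∃₂ λ x′ y′ → shift (squiral N) i j ≈[ suc a , suc b ] shift (squiral 2) x′ y′
  conclude (inj₂ (x′ , _ , y′ , _ , same′)) = x′ , y′ , ≈-trans same same′
  conclude (inj₁ undefined) with subst Is-just undefined defined₃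
  ... | ()

-- Definedness of the bottom-right corner says that the window lies inside T_N. Passing to the
-- parent window turns the side bound size J + 1 into size (pred J) + 1; for J = 0 this is a fixed
-- point, so the expansion lands in T₃ and the finite check brings it back to T₂.
window-in-T[2+J] : ∀ N J {i j a b} → a ≤ size J → b ≤ size J → Is-just (squiral N (i + a) (j + b)) →
  ∃₂ λ x y → shift (squiral N) i j ≈[ suc a , suc b ] shift (squiral (2 + J)) x y
window-in-T[2+J] zero J {zero} {zero} {zero} {zero} _ _ _ = centre (2 + J) , centre (2 + J) , origin
  where
  origin : shift (squiral 0) 0 0 ≈[ 1 , 1 ] shift (squiral (2 + J)) (centre (2 + J)) (centre (2 + J))
  origin {zero}  _       {zero}  _       =
    sym (trans (cong₂ (squiral (2 + J)) (+-identityʳ (centre (2 + J))) (+-identityʳ (centre (2 + J))))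
               (squiral-centre (2 + J)))
  origin {suc _} (s≤s ())
  origin {zero}  _       {suc _} (s≤s ())
window-in-T[2+J] zero J {suc _} {_}     {_}     {_}     _ _ ()
window-in-T[2+J] zero J {zero}  {_}     {suc _} {_}     _ _ ()
window-in-T[2+J] zero J {zero}  {suc _} {zero}  {_}     _ _ ()
window-in-T[2+J] zero J {zero}  {zero}  {zero}  {suc _} _ _ ()
window-in-T[2+J] (suc N) J {i} {j} {a} {b} a≤ b≤ defined
  with window-in-T[2+J] N (pred J) (parent-extent J {i} a≤) (parent-extent J {j} b≤)
                          (parent-defined N {i} {j} {a} {b} defined)
... | x , y , parents = descend J a≤ b≤ (expand-window {N} {2 + pred J} {i} {j} {a} {b} {x} {y} parents)
  where
  descend : ∀ J → a ≤ size J → b ≤ size J →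
    shift (squiral (suc N)) i j ≈[ suc a , suc b ] shift (squiral (3 + pred J)) (x * 3 + i % 3) (y * 3 + j % 3) →
    ∃₂ λ x y → shift (squiral (suc N)) i j ≈[ suc a , suc b ] shift (squiral (2 + J)) x y
  descend zero    a≤1 b≤1 same =
    window-T₃⇒T₂ {suc N} {i} {j} {a} {b} {x * 3 + i % 3} {y * 3 + j % 3} a≤1 b≤1 defined same
  descend (suc J) _   _   same = x * 3 + i % 3 , y * 3 + j % 3 , same

n<size : ∀ n → n < size n
n<size zero    = s≤s z≤n
n<size (suc n) = begin-strict
  suc n             ≤⟨ n<size n ⟩
  size n            <⟨ m<m+n (size n) (≤-trans (s≤s z≤n) (n<size n)) ⟩
  size n + size n   ≤⟨ +-monoʳ-≤ (size n) (m≤m+n (size n) (size n + 0)) ⟩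
  3 * size n        ≡⟨ *-comm 3 (size n) ⟩
  size n * 3        ∎
  where open ≤-Reasoning

OccursIn-T⇔≈ : ∀ (p : Matrix m n) k →
               OccursIn p (T k) ⇔ ∃₂ λ i j → shift (squiral k) i j ≈[ m , n ] entry p
OccursIn-T⇔≈ {m} {n} p k = mk⇔ to from
  where
  to : OccursIn p (T k) → ∃₂ λ i j → shift (squiral k) i j ≈[ m , n ] entry p
  to (i , j , occ) = i , j , λ r<m c<n →
    subst₂ (λ r c → squiral k (i + r) (j + c) ≡ entry p r c) (toℕ-fromℕ< r<m) (toℕ-fromℕ< c<n)
      (trans (sym (entry-T k _ _)) (trans (occ (fromℕ< r<m) (fromℕ< c<n)) (sym (entry-lookup p _ _))))
  from : (∃₂ λ i j → shift (squiral k) i j ≈[ m , n ] entry p) → OccursIn p (T k)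
  from (i , j , same) = i , j , λ a b →
    trans (entry-T k _ _) (trans (same (toℕ<n a) (toℕ<n b)) (entry-lookup p a b))

InP⇒OccursIn-T[2+a+b] : ∀ {a b} (p : Matrix (suc a) (suc b)) → InP p → OccursIn p (T (2 + (a + b)))
InP⇒OccursIn-T[2+a+b] {a} {b} p (k , occ) with Equivalence.to (OccursIn-T⇔≈ p k) occ
... | i , j , same
  with window-in-T[2+J] k (a + b) (≤-trans (m≤m+n a b) (<⇒≤ (n<size (a + b))))
                               (≤-trans (m≤n+m b a) (<⇒≤ (n<size (a + b))))
                               (subst Is-just (sym (same ≤-refl ≤-refl)) (entry-defined p ≤-refl ≤-refl))
... | x , y , same′ = Equivalence.from (OccursIn-T⇔≈ p (2 + (a + b))) (x , y , ≈-trans (≈-sym same′) same)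

OccursIn-T-dec : ∀ {a b} (p : Matrix (suc a) (suc b)) k → Dec (OccursIn p (T k))
OccursIn-T-dec {a} {b} p k = Dec.map′ bounded→ →bounded
  (anyUpTo? (λ i → anyUpTo? (λ j → ≈-dec (shift (squiral k) i j) (entry p) (suc a) (suc b)) (size k)) (size k))
  where
  Bounded : Set
  Bounded = ∃ λ i → i < size k × ∃ λ j → j < size k × shift (squiral k) i j ≈[ suc a , suc b ] entry p
  bounded→ : Bounded → OccursIn p (T k)
  bounded→ (i , _ , j , _ , same) = Equivalence.from (OccursIn-T⇔≈ p k) (i , j , same)
  →bounded : OccursIn p (T k) → Bounded
  →bounded occ with Equivalence.to (OccursIn-T⇔≈ p k) occ
  ... | i , j , same with squiral-bound k (i + 0) (j + 0) (subst Is-just (sym (same (s≤s z≤n) (s≤s z≤n)))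
                                                                        (entry-defined p (s≤s z≤n) (s≤s z≤n)))
  ... | i<size , j<size = i , m+n≤o⇒m≤o (suc i) i<size , j , m+n≤o⇒m≤o (suc j) j<size , same

InP-dec : ∀ {a b} → Decidable (InP {suc a} {suc b})
InP-dec {a} {b} p = Dec.map′ (2 + (a + b) ,_) (InP⇒OccursIn-T[2+a+b] p) (OccursIn-T-dec p (2 + (a + b)))

InP-ᵀ : ∀ (p : Matrix m n) → InP p → InP (p ᵀ)
InP-ᵀ p (k , i , j , occ) = k , j , i , λ b a → begin
  entry (T k) (j + toℕ b) (i + toℕ a)  ≡⟨ entry-T k _ _ ⟩
  squiral k (j + toℕ b) (i + toℕ a)    ≡⟨ squiral-sym k _ _ ⟩
  squiral k (i + toℕ a) (j + toℕ b)    ≡⟨ entry-T k _ _ ⟨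
  entry (T k) (i + toℕ a) (j + toℕ b)  ≡⟨ occ a b ⟩
  just (lookup (lookup p a) b)         ≡⟨ cong just (lookup-ᵀ p a b) ⟨
  just (lookup (lookup (p ᵀ) b) a)     ∎
  where open ≡-Reasoning

-- Counting patterns

vectors : List A → ∀ n → List (Vec A n)
vectors xs zero    = [] ∷ []
vectors xs (suc n) = cartesianProductWith _∷_ xs (vectors xs n)

∈-vectors : ∀ {xs : List A} → (∀ x → x ∈ xs) → (v : Vec A n) → v ∈ vectors xs n
∈-vectors ∈xs []       = here refl
∈-vectors ∈xs (x ∷ v) = ∈-cartesianProductWith⁺ _∷_ (∈xs x) (∈-vectors ∈xs v)

∈-booleans : ∀ b → b ∈ true ∷ false ∷ []
∈-booleans true  = here refl
∈-booleans false = there (here refl)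

matrices : ∀ m n → List (Matrix m n)
matrices m n = vectors (vectors (true ∷ false ∷ []) n) m

∈-matrices : ∀ (M : Matrix m n) → M ∈ matrices m n
∈-matrices = ∈-vectors (∈-vectors ∈-booleans)

≟-Matrix : DecidableEquality (Matrix m n)
≟-Matrix = Vec.≡-dec (Vec.≡-dec Bool._≟_)

Decidable⇒HasCard : ∀ {P : A → Set} → DecidableEquality A →
                    (xs : List A) → (∀ x → x ∈ xs) → Decidable P → ∃ (HasCard P)
Decidable⇒HasCard {A} {P} _≟_ xs ∈xs P? = length ys , ys , deduplicate-! _≟_ (filter P? xs) , members , refl
  where
  ys : List A
  ys = deduplicate _≟_ (filter P? xs)
  members : ∀ x → x ∈ ys ⇔ P x
  members x = mk⇔ (λ x∈ys → proj₂ (∈-filter⁻ P? {xs = xs} (∈-deduplicate⁻ _≟_ (filter P? xs) x∈ys)))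
                  (λ Px → ∈-deduplicate⁺ _≟_ (∈-filter⁺ P? (∈xs x) Px))

HasCard-↔ : ∀ {P : A → Set} {Q : B → Set} {N} (e : A ↔ B) → let open Inverse e in
            (∀ x → P x → Q (to x)) → (∀ y → Q y → P (from y)) → HasCard P N → HasCard Q N
HasCard-↔ {Q = Q} e P⇒Q Q⇒P (xs , unique , members , len) =
  List.map to xs , Unique.map⁺ to-injective unique , members′ , trans (length-map to xs) len
  where
  open Inverse e
  to-injective : ∀ {x y} → to x ≡ to y → x ≡ y
  to-injective {x} {y} eq = trans (sym (strictlyInverseʳ x)) (trans (cong from eq) (strictlyInverseʳ y))
  members′ : ∀ y → y ∈ List.map to xs ⇔ Q y
  members′ y = mk⇔
    (λ y∈ → let x , x∈xs , y≡ = ∈-map⁻ to y∈ in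
            subst Q (sym y≡) (P⇒Q x (Equivalence.to (members x) x∈xs)))
    (λ Qy → subst (_∈ List.map to xs) (strictlyInverseˡ y)
              (∈-map⁺ to (Equivalence.from (members (from y)) (Q⇒P y Qy))))

ᵀ-↔ : Matrix m n ↔ Matrix n m
ᵀ-↔ = mk↔ₛ′ _ᵀ _ᵀ ᵀ-involutive ᵀ-involutive

lemma5 : (n : ℕ) → n ≥ 1 → Σ ℕ λ N → CardP n (suc n) N × CardP (suc n) n N
lemma5 zero    ()
lemma5 (suc n) _ with Decidable⇒HasCard ≟-Matrix (matrices (suc n) (2 + n)) ∈-matrices InP-dec
... | N , card = N , card , HasCard-↔ ᵀ-↔ InP-ᵀ InP-ᵀ card
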